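{- For every positive integer $n$, the hypercube $Q_n$ can be decomposed into antipodal paths of length $n$.
   Context: The $n$-dimensional hypercube $Q_n$ is the graph with vertex set $\{0,1\}^n$ in which two vertices $x,y$ are adjacent iff $\|x-y\|_1 = 1$. A path of length $k$ is a sequence of distinct vertices $x_1,\dots,x_{k+1}$ with $x_i x_{i+1}$ an edge for all $1\le i\le k$. Two vertices $x,y$ of $Q_n$ are antipodal if $\|x-y\|_1=n$; an antipodal path is a path of length $n$ between two antipodal vertices. A decomposition of a graph into a family of paths means the edge sets of the paths partition the edge set of the graph. -}

module Defs where

open import Data.Nat using (ℕ; zero; suc; _+_)
open import Data.Bool using (Bool; true; false; if_then_else_)
import Data.Bool.Properties as BoolP
open import Data.Vec using (Vec; []; _∷_)
import Data.Vec.Properties as VecP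
open import Data.List using (List; []; _∷_; length; head; last; map)
open import Data.Nat.ListAction using (sum)
open import Data.List.Relation.Unary.All using (All)
open import Data.List.Relation.Unary.Unique.Propositional using (Unique)
open import Data.List.Relation.Unary.Linked using (Linked)
open import Data.Maybe using (just)
open import Data.Product using (_×_; ∃₂)
open import Relation.Binary.PropositionalEquality using (_≡_)
open import Relation.Nullary using (Dec; yes; no)
open import Relation.Nullary.Decidable using (⌊_⌋)
open import Data.Bool using (_∨_; _∧_)

Vertex : ℕ → Set
Vertex n = Vec Bool n

dist : ∀ {n} → Vertex n → Vertex n → ℕ
dist [] [] = 0
dist (a ∷ x) (b ∷ y) = (if ⌊ a BoolP.≟ b ⌋ then 0 else 1) + dist x y

Adjacent : ∀ {n} → Vertex n → Vertex n → Set
Adjacent x y = dist x y ≡ 1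

IsPath : ∀ {n} → ℕ → List (Vertex n) → Set
IsPath k p = (length p ≡ suc k) × Unique p × Linked Adjacent p

IsAntipodalPath : ∀ n → List (Vertex n) → Set
IsAntipodalPath n p =
  IsPath n p × ∃₂ λ x y → (head p ≡ just x) × (last p ≡ just y) × (dist x y ≡ n)

_≟V_ : ∀ {n} → (x y : Vertex n) → Dec (x ≡ y)
_≟V_ = VecP.≡-dec BoolP._≟_

edgeCount : ∀ {n} → Vertex n → Vertex n → List (Vertex n) → ℕ
edgeCount x y [] = 0
edgeCount x y (u ∷ []) = 0
edgeCount x y (u ∷ v ∷ p) =
  (if (⌊ u ≟V x ⌋ ∧ ⌊ v ≟V y ⌋) ∨ (⌊ u ≟V y ⌋ ∧ ⌊ v ≟V x ⌋) then 1 else 0)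
  + edgeCount x y (v ∷ p)

-- A family of paths decomposes Q_n: every edge of Q_n is used exactly once
-- in total (edges of paths are edges of Q_n by IsPath).
Decomposes : ∀ n → List (List (Vertex n)) → Set
Decomposes n ps =
  ∀ (x y : Vertex n) → Adjacent x y → sum (map (edgeCount x y) ps) ≡ 1

AntipodalPathDecomposition : ℕ → Set
AntipodalPathDecomposition n =
  Data.Product.Σ (List (List (Vertex n))) λ ps →
    All (IsAntipodalPath n) ps × Decomposes n ps

-- Start a path at w and flip the coordinates of w one at a time, from left to
-- right; it ends at the complement of w, so it is antipodal. Taking one such
-- path from every vertex of even weight decomposes Q_n. Split Q_(n+1) along the
-- first coordinate: a path from (c ∷ w) crosses once, along (c ∷ w)(¬c ∷ w), and
-- then runs as the path from w inside the subcube ¬c. An edge inside a subcube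
-- is therefore covered by the decomposition of Q_n of the appropriate parity,
-- and the crossing edge (a ∷ z)(¬a ∷ z) is used exactly by the paths starting at
-- (false ∷ z) and (true ∷ z), of which precisely one has even weight.
module Submission where

open import Defs
open import Data.Bool using (Bool; true; false; not; _xor_; if_then_else_)
open import Data.Bool.Properties using (not-¬) renaming (_≟_ to _≟ᵇ_)
open import Data.List using (List; []; _∷_; _++_; map; length; last)
open import Data.List.Properties using (map-++; map-∘; map-cong; map-id; length-map; last-map)
open import Data.List.Relation.Unary.All as All using (All; []; _∷_)
import Data.List.Relation.Unary.All.Properties as All
open import Data.List.Relation.Unary.AllPairs using ([]; _∷_)
open import Data.List.Relation.Unary.Linked as Linked using (Linked; [-]; _∷_)
import Data.List.Relation.Unary.Linked.Properties as Linked
open import Data.List.Relation.Unary.Unique.Propositional using (Unique)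
import Data.List.Relation.Unary.Unique.Propositional.Properties as Unique
open import Data.Maybe using (just)
import Data.Maybe as Maybe
open import Data.Nat using (ℕ; zero; suc; _+_; _≤_)
open import Data.Nat.ListAction using (sum)
open import Data.Nat.ListAction.Properties using (sum-++)
open import Data.Nat.Properties using (+-identityʳ; suc-injective)
open import Data.Product using (_×_; _,_)
import Data.Product as Product
open import Data.Sum using (_⊎_; inj₁; inj₂)
import Data.Sum as Sum
import Data.Vec as Vec
open import Data.Vec using ([]; _∷_)
open import Data.Vec.Properties using (∷-injectiveˡ; ∷-injectiveʳ)
open import Function using (_∘_; _⇔_; mk⇔)
open import Relation.Binary.PropositionalEquality
  using (_≡_; _≢_; refl; sym; trans; cong; cong₂; module ≡-Reasoning)
open import Relation.Nullary using (Dec; does; yes; no; ¬_)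
open import Relation.Nullary.Decidable using (_×-dec_; _⊎-dec_; dec-false; does-⇔; isYes≗does)

𝟙 : Bool → ℕ
𝟙 b = if b then 1 else 0

sum-map-cong : ∀ {A : Set} {f g : A → ℕ} → (∀ x → f x ≡ g x) →
               ∀ xs → sum (map f xs) ≡ sum (map g xs)
sum-map-cong f≗g xs = cong sum (map-cong f≗g xs)

sum-map-zero : ∀ {A : Set} {f : A → ℕ} → (∀ x → f x ≡ 0) → ∀ xs → sum (map f xs) ≡ 0
sum-map-zero f≗0 []       = refl
sum-map-zero f≗0 (x ∷ xs) = cong₂ _+_ (f≗0 x) (sum-map-zero f≗0 xs)

∷-≢-not∷ : ∀ {n} {c : Bool} {u v : Vertex n} → c ∷ u ≢ not c ∷ v
∷-≢-not∷ eq = not-¬ refl (∷-injectiveˡ eq)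

complement : ∀ {n} → Vertex n → Vertex n
complement = Vec.map not

dist-∷-∷ : ∀ {n} c (x y : Vertex n) → dist (c ∷ x) (c ∷ y) ≡ dist x y
dist-∷-∷ false x y = refl
dist-∷-∷ true  x y = refl

dist-refl : ∀ {n} (x : Vertex n) → dist x x ≡ 0
dist-refl []      = refl
dist-refl (c ∷ x) = trans (dist-∷-∷ c x x) (dist-refl x)

dist≡0⇒≡ : ∀ {n} (x y : Vertex n) → dist x y ≡ 0 → x ≡ y
dist≡0⇒≡ []          []          _  = refl
dist≡0⇒≡ (false ∷ x) (false ∷ y) eq = cong (false ∷_) (dist≡0⇒≡ x y eq)
dist≡0⇒≡ (true ∷ x)  (true ∷ y)  eq = cong (true ∷_) (dist≡0⇒≡ x y eq)

dist-complement : ∀ {n} (x : Vertex n) → dist x (complement x) ≡ n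
dist-complement []          = refl
dist-complement (false ∷ x) = cong suc (dist-complement x)
dist-complement (true ∷ x)  = cong suc (dist-complement x)

adjacent-flip : ∀ {n} c (x : Vertex n) → Adjacent (c ∷ x) (not c ∷ x)
adjacent-flip false x = cong suc (dist-refl x)
adjacent-flip true  x = cong suc (dist-refl x)

adjacent-∷ : ∀ {n} c {x y : Vertex n} → Adjacent x y → Adjacent (c ∷ x) (c ∷ y)
adjacent-∷ c {x} {y} adj = trans (dist-∷-∷ c x y) adj

adjacent-∷⁻ : ∀ {n} a b (x y : Vertex n) → Adjacent (a ∷ x) (b ∷ y) →
              (b ≡ a × Adjacent x y) ⊎ (b ≡ not a × x ≡ y)
adjacent-∷⁻ false false x y adj = inj₁ (refl , adj)
adjacent-∷⁻ true  true  x y adj = inj₁ (refl , adj)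
adjacent-∷⁻ false true  x y adj = inj₂ (refl , dist≡0⇒≡ x y (suc-injective adj))
adjacent-∷⁻ true  false x y adj = inj₂ (refl , dist≡0⇒≡ x y (suc-injective adj))

flipPath : ∀ {n} → Vertex n → List (Vertex n)
flips    : ∀ {n} → Vertex n → List (Vertex n)

flipPath w = w ∷ flips w
flips []      = []
flips (c ∷ w) = map (not c ∷_) (flipPath w)

length-flipPath : ∀ {n} (w : Vertex n) → length (flipPath w) ≡ suc n
length-flipPath []      = refl
length-flipPath (c ∷ w) =
  cong suc (trans (length-map (not c ∷_) (flipPath w)) (length-flipPath w))

last-flipPath : ∀ {n} (w : Vertex n) → last (flipPath w) ≡ just (complement w)
last-flipPath []      = refl
last-flipPath (c ∷ w) =
  trans (last-map (not c ∷_) (flipPath w)) (cong (Maybe.map (not c ∷_)) (last-flipPath w))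

flipPath-unique : ∀ {n} (w : Vertex n) → Unique (flipPath w)
flipPath-unique []      = [] ∷ []
flipPath-unique (c ∷ w) =
  All.map⁺ (All.universal (λ _ → ∷-≢-not∷) (flipPath w))
  ∷ Unique.map⁺ ∷-injectiveʳ (flipPath-unique w)

flipPath-linked : ∀ {n} (w : Vertex n) → Linked Adjacent (flipPath w)
flipPath-linked []      = [-]
flipPath-linked (c ∷ w) =
  adjacent-flip c w
  ∷ Linked.map⁺ (Linked.map (λ {x y} → adjacent-∷ (not c) {x} {y}) (flipPath-linked w))

flipPath-antipodal : ∀ {n} (w : Vertex n) → IsAntipodalPath n (flipPath w)
flipPath-antipodal w =
  (length-flipPath w , flipPath-unique w , flipPath-linked w) ,
  w , complement w , refl , last-flipPath w , dist-complement w

SameEdge : ∀ {n} → Vertex n → Vertex n → Vertex n → Vertex n → Set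
SameEdge x y u v = (u ≡ x × v ≡ y) ⊎ (u ≡ y × v ≡ x)

sameEdge? : ∀ {n} (x y u v : Vertex n) → Dec (SameEdge x y u v)
sameEdge? x y u v = (u ≟V x ×-dec v ≟V y) ⊎-dec (u ≟V y ×-dec v ≟V x)

edgeCount-∷-∷ : ∀ {n} (x y u v : Vertex n) p →
                edgeCount x y (u ∷ v ∷ p) ≡ 𝟙 (does (sameEdge? x y u v)) + edgeCount x y (v ∷ p)
edgeCount-∷-∷ x y u v p
  rewrite isYes≗does (u ≟V x) | isYes≗does (v ≟V y)
        | isYes≗does (u ≟V y) | isYes≗does (v ≟V x) = refl

edgeCount-map : ∀ {m n} {f : Vertex m → Vertex n} {x′ y′ : Vertex n} {x y : Vertex m} →
                (∀ u v → SameEdge x′ y′ (f u) (f v) ⇔ SameEdge x y u v) →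
                ∀ q → edgeCount x′ y′ (map f q) ≡ edgeCount x y q
edgeCount-map same []          = refl
edgeCount-map same (u ∷ [])    = refl
edgeCount-map {f = f} {x′} {y′} {x} {y} same (u ∷ v ∷ q) = begin
  edgeCount x′ y′ (map f (u ∷ v ∷ q))
    ≡⟨ edgeCount-∷-∷ x′ y′ (f u) (f v) (map f q) ⟩
  𝟙 (does (sameEdge? x′ y′ (f u) (f v))) + edgeCount x′ y′ (map f (v ∷ q))
    ≡⟨ cong₂ _+_ (cong 𝟙 (does-⇔ (same u v) (sameEdge? x′ y′ (f u) (f v)) (sameEdge? x y u v)))
                 (edgeCount-map same (v ∷ q)) ⟩
  𝟙 (does (sameEdge? x y u v)) + edgeCount x y (v ∷ q)
    ≡⟨ edgeCount-∷-∷ x y u v q ⟨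
  edgeCount x y (u ∷ v ∷ q) ∎
  where open ≡-Reasoning

edgeCount-comm : ∀ {n} (x y : Vertex n) q → edgeCount x y q ≡ edgeCount y x q
edgeCount-comm x y q =
  trans (cong (edgeCount x y) (sym (map-id q)))
        (edgeCount-map (λ _ _ → mk⇔ Sum.swap Sum.swap) q)

edgeCount-map-injective : ∀ {m n} {f : Vertex m → Vertex n} → (∀ {u v} → f u ≡ f v → u ≡ v) →
                          ∀ x y q → edgeCount (f x) (f y) (map f q) ≡ edgeCount x y q
edgeCount-map-injective {f = f} f-inj x y = edgeCount-map λ _ _ →
  mk⇔ (Sum.map (Product.map f-inj f-inj) (Product.map f-inj f-inj))
      (Sum.map (Product.map (cong f) (cong f)) (Product.map (cong f) (cong f)))

edgeCount-∉ : ∀ {n} {x y : Vertex n} {q} → All (_≢ x) q → edgeCount x y q ≡ 0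
edgeCount-∉ []       = refl
edgeCount-∉ (_ ∷ []) = refl
edgeCount-∉ {x = x} {y} {u ∷ v ∷ q} (u≢x ∷ v≢x ∷ rest) =
  trans (edgeCount-∷-∷ x y u v q)
        (cong₂ _+_ (cong 𝟙 (dec-false (sameEdge? x y u v) absent)) (edgeCount-∉ (v≢x ∷ rest)))
  where
  absent : ¬ SameEdge x y u v
  absent (inj₁ (u≡x , _)) = u≢x u≡x
  absent (inj₂ (_ , v≡x)) = v≢x v≡x

edgeCount-map-∷-∉ : ∀ {n} {a c : Bool} {x : Vertex n} {y : Vertex (suc n)} → a ≢ c →
                    ∀ q → edgeCount (a ∷ x) y (map (c ∷_) q) ≡ 0
edgeCount-map-∷-∉ a≢c q =
  edgeCount-∉ (All.map⁺ (All.universal (λ _ eq → a≢c (sym (∷-injectiveˡ eq))) q))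

edgeCount-map-∷-across : ∀ {n} a c (x y : Vertex n) q →
                         edgeCount (a ∷ x) (not a ∷ y) (map (c ∷_) q) ≡ 0
edgeCount-map-∷-across a c x y q with a ≟ᵇ c
... | no a≢c   = edgeCount-map-∷-∉ a≢c q
... | yes refl = trans (edgeCount-comm (a ∷ x) (not a ∷ y) (map (a ∷_) q))
                       (edgeCount-map-∷-∉ (λ eq → not-¬ refl (sym eq)) q)

crossing-¬SameEdge : ∀ {n} a c (x y w : Vertex n) → ¬ SameEdge (a ∷ x) (a ∷ y) (c ∷ w) (not c ∷ w)
crossing-¬SameEdge a c x y w (inj₁ (refl , eq)) = not-¬ refl (sym (∷-injectiveˡ eq))
crossing-¬SameEdge a c x y w (inj₂ (refl , eq)) = not-¬ refl (sym (∷-injectiveˡ eq))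

crossing-SameEdge : ∀ {n} a c (w : Vertex n) → SameEdge (a ∷ w) (not a ∷ w) (c ∷ w) (not c ∷ w)
crossing-SameEdge false false w = inj₁ (refl , refl)
crossing-SameEdge true  true  w = inj₁ (refl , refl)
crossing-SameEdge false true  w = inj₂ (refl , refl)
crossing-SameEdge true  false w = inj₂ (refl , refl)

crossing-SameEdge⇔ : ∀ {n} a c (z w : Vertex n) →
                     SameEdge (a ∷ z) (not a ∷ z) (c ∷ w) (not c ∷ w) ⇔ w ≡ z
crossing-SameEdge⇔ a c z w = mk⇔ to λ { refl → crossing-SameEdge a c w }
  where
  to : SameEdge (a ∷ z) (not a ∷ z) (c ∷ w) (not c ∷ w) → w ≡ z
  to (inj₁ (eq , _)) = ∷-injectiveʳ eq
  to (inj₂ (eq , _)) = ∷-injectiveʳ eq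

edgeCount-flipPath-∷ : ∀ {n} (x y : Vertex (suc n)) c w →
                       edgeCount x y (flipPath (c ∷ w))
                       ≡ 𝟙 (does (sameEdge? x y (c ∷ w) (not c ∷ w)))
                         + edgeCount x y (map (not c ∷_) (flipPath w))
edgeCount-flipPath-∷ x y c w = edgeCount-∷-∷ x y (c ∷ w) (not c ∷ w) (map (not c ∷_) (flips w))

edgeCount-flipPath-within : ∀ {n} a c (x y w : Vertex n) →
                            edgeCount (a ∷ x) (a ∷ y) (flipPath (c ∷ w))
                            ≡ edgeCount (a ∷ x) (a ∷ y) (map (not c ∷_) (flipPath w))
edgeCount-flipPath-within a c x y w =
  trans (edgeCount-flipPath-∷ (a ∷ x) (a ∷ y) c w)
        (cong (λ k → 𝟙 k + edgeCount (a ∷ x) (a ∷ y) (map (not c ∷_) (flipPath w)))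
              (dec-false (sameEdge? _ _ _ _) (crossing-¬SameEdge a c x y w)))

edgeCount-flipPath-inside : ∀ {n} c (x y w : Vertex n) →
                            edgeCount (not c ∷ x) (not c ∷ y) (flipPath (c ∷ w)) ≡ edgeCount x y (flipPath w)
edgeCount-flipPath-inside c x y w =
  trans (edgeCount-flipPath-within (not c) c x y w) (edgeCount-map-injective ∷-injectiveʳ x y (flipPath w))

edgeCount-flipPath-outside : ∀ {n} c (x y w : Vertex n) →
                             edgeCount (c ∷ x) (c ∷ y) (flipPath (c ∷ w)) ≡ 0
edgeCount-flipPath-outside c x y w =
  trans (edgeCount-flipPath-within c c x y w) (edgeCount-map-∷-∉ (not-¬ refl) (flipPath w))

edgeCount-flipPath-across : ∀ {n} a c (z w : Vertex n) →
                            edgeCount (a ∷ z) (not a ∷ z) (flipPath (c ∷ w)) ≡ 𝟙 (does (w ≟V z))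
edgeCount-flipPath-across a c z w = begin
  edgeCount (a ∷ z) (not a ∷ z) (flipPath (c ∷ w))
    ≡⟨ edgeCount-flipPath-∷ (a ∷ z) (not a ∷ z) c w ⟩
  𝟙 (does (sameEdge? (a ∷ z) (not a ∷ z) (c ∷ w) (not c ∷ w)))
    + edgeCount (a ∷ z) (not a ∷ z) (map (not c ∷_) (flipPath w))
    ≡⟨ cong₂ _+_ (cong 𝟙 (does-⇔ (crossing-SameEdge⇔ a c z w) (sameEdge? _ _ _ _) (w ≟V z)))
                 (edgeCount-map-∷-across a (not c) z z (flipPath w)) ⟩
  𝟙 (does (w ≟V z)) + 0
    ≡⟨ +-identityʳ _ ⟩
  𝟙 (does (w ≟V z)) ∎
  where open ≡-Reasoning

-- The vertices whose number of true coordinates has parity p (false = even).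
ofParity : ∀ n → Bool → List (Vertex n)
ofParity zero    false = [] ∷ []
ofParity zero    true  = []
ofParity (suc n) p     = map (false ∷_) (ofParity n p) ++ map (true ∷_) (ofParity n (not p))

sum-ofParity-suc : ∀ n p (g : Vertex (suc n) → ℕ) →
                   sum (map g (ofParity (suc n) p))
                   ≡ sum (map (g ∘ (false ∷_)) (ofParity n p)) + sum (map (g ∘ (true ∷_)) (ofParity n (not p)))
sum-ofParity-suc n p g = begin
  sum (map g (map (false ∷_) evens ++ map (true ∷_) odds))
    ≡⟨ cong sum (map-++ g (map (false ∷_) evens) (map (true ∷_) odds)) ⟩
  sum (map g (map (false ∷_) evens) ++ map g (map (true ∷_) odds))
    ≡⟨ sum-++ (map g (map (false ∷_) evens)) (map g (map (true ∷_) odds)) ⟩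
  sum (map g (map (false ∷_) evens)) + sum (map g (map (true ∷_) odds))
    ≡⟨ cong₂ _+_ (cong sum (map-∘ evens)) (cong sum (map-∘ odds)) ⟨
  sum (map (g ∘ (false ∷_)) evens) + sum (map (g ∘ (true ∷_)) odds) ∎
  where
  open ≡-Reasoning
  evens odds : List (Vertex n)
  evens = ofParity n p
  odds  = ofParity n (not p)

occurrences : ∀ {n} → Vertex n → List (Vertex n) → ℕ
occurrences z q = sum (map (λ w → 𝟙 (does (w ≟V z))) q)

occurrences-ofParity-suc : ∀ n p c (z : Vertex n) →
                           occurrences (c ∷ z) (ofParity (suc n) p) ≡ occurrences z (ofParity n (c xor p))
occurrences-ofParity-suc n p false z =
  trans (sum-ofParity-suc n p _)
        (trans (cong (occurrences z (ofParity n p) +_) (sum-map-zero (λ _ → refl) (ofParity n (not p))))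
               (+-identityʳ _))
occurrences-ofParity-suc n p true z =
  trans (sum-ofParity-suc n p _)
        (cong (_+ occurrences z (ofParity n (not p))) (sum-map-zero (λ _ → refl) (ofParity n p)))

occurrences-ofParity : ∀ n p (z : Vertex n) →
                       occurrences z (ofParity n p) + occurrences z (ofParity n (not p)) ≡ 1
occurrences-ofParity zero false [] = refl
occurrences-ofParity zero true  [] = refl
occurrences-ofParity (suc n) p (false ∷ z) =
  trans (cong₂ _+_ (occurrences-ofParity-suc n p false z) (occurrences-ofParity-suc n (not p) false z))
        (occurrences-ofParity n p z)
occurrences-ofParity (suc n) p (true ∷ z) =
  trans (cong₂ _+_ (occurrences-ofParity-suc n p true z) (occurrences-ofParity-suc n (not p) true z))
        (occurrences-ofParity n (not p) z)

traversals : ∀ {n} → Vertex n → Vertex n → Bool → ℕ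
traversals {n} x y p = sum (map (edgeCount x y ∘ flipPath) (ofParity n p))

traversals-within : ∀ {n} a (x y : Vertex n) p → traversals (a ∷ x) (a ∷ y) p ≡ traversals x y (not a xor p)
traversals-within {n} true x y p =
  trans (sum-ofParity-suc n p _)
        (trans (cong₂ _+_ (sum-map-cong (edgeCount-flipPath-inside false x y) (ofParity n p))
                          (sum-map-zero (edgeCount-flipPath-outside true x y) (ofParity n (not p))))
               (+-identityʳ _))
traversals-within {n} false x y p =
  trans (sum-ofParity-suc n p _)
        (cong₂ _+_ (sum-map-zero (edgeCount-flipPath-outside false x y) (ofParity n p))
                   (sum-map-cong (edgeCount-flipPath-inside true x y) (ofParity n (not p))))

traversals-across : ∀ {n} a (z : Vertex n) p →
                    traversals (a ∷ z) (not a ∷ z) p ≡ occurrences z (ofParity n p) + occurrences z (ofParity n (not p))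
traversals-across {n} a z p =
  trans (sum-ofParity-suc n p _)
        (cong₂ _+_ (sum-map-cong (edgeCount-flipPath-across a false z) (ofParity n p))
                   (sum-map-cong (edgeCount-flipPath-across a true z) (ofParity n (not p))))

traversals-adjacent : ∀ n p (x y : Vertex n) → Adjacent x y → traversals x y p ≡ 1
traversals-adjacent zero    p []      []      ()
traversals-adjacent (suc n) p (a ∷ x) (b ∷ y) adj with adjacent-∷⁻ a b x y adj
... | inj₁ (refl , adj′) = trans (traversals-within a x y p) (traversals-adjacent n (not a xor p) x y adj′)
... | inj₂ (refl , refl) = trans (traversals-across a x p) (occurrences-ofParity n p x)

flipPaths-decompose : ∀ n → Decomposes n (map flipPath (ofParity n false))
flipPaths-decompose n x y adj =
  trans (cong sum (sym (map-∘ (ofParity n false)))) (traversals-adjacent n false x y adj)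

lemma2p1 : ∀ (n : ℕ) → 1 ≤ n → AntipodalPathDecomposition n
lemma2p1 n _ =
  map flipPath (ofParity n false) ,
  All.map⁺ (All.universal flipPath-antipodal (ofParity n false)) ,
  flipPaths-decompose n
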